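{- Let $p$ be a prime and $k$ a positive integer. For $d\in\mathbb{Z}_p^*$ let $B_{k,p}(d)=\{ -kd,-(k-1)d,\ldots,-d,d,2d,\ldots,kd\}\subseteq\mathbb{Z}_p^*$. Let $D\subseteq\mathbb{Z}_p^*$ be such that $\bigcup_{d\in D}B_{k,p}(d)=\mathbb{Z}_p^*$. Then there exists a $p$-ary $k$-radius sequence of length $|D|(p+k-1)+1$.
   Context: An $n$-ary $k$-radius sequence is a finite sequence $a_0,\ldots,a_{m-1}$ of elements of $\{0,\ldots,n-1\}$ such that for all distinct $x,y$ in this set there exist $i,j$ with $a_i=x$, $a_j=y$, $|i-j|\le k$. -}

module Defs where

open import Data.Nat using (ℕ; zero; suc; _+_; _*_; _≤_; _%_; ∣_-_∣)
open import Data.Fin using (Fin; toℕ)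
open import Data.Fin.Subset using (Subset; _∈_)
open import Data.Vec using (Vec; lookup)
open import Data.Product using (Σ; ∃; ∃-syntax; _×_; _,_)
open import Data.Sum using (_⊎_)
open import Relation.Binary.PropositionalEquality using (_≡_; _≢_)

-- ℤ_p is represented by Fin p (residues 0..p-1); ℤ_p^* = nonzero residues.

InB : (k p : ℕ) .{{_ : Data.Nat.NonZero p}} → Fin p → Fin p → Set
InB k p d x =
  ∃[ i ] (1 ≤ i × i ≤ k ×
    (toℕ x ≡ (i * toℕ d) % p ⊎ (toℕ x + i * toℕ d) % p ≡ 0))

IsRadiusSeq : (n k m : ℕ) → Vec (Fin n) m → Set
IsRadiusSeq n k m a =
  (x y : Fin n) → x ≢ y →
    ∃[ i ] ∃[ j ] (lookup a i ≡ x × lookup a j ≡ y × ∣ toℕ i - toℕ j ∣ ≤ k)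

module Submission where

-- Let L = p + k - 1 and list the
-- elements of D as d₁ < … < d_r.  Consider the step list consisting of L
-- copies of d₁, then L copies of d₂, …, then L copies of d_r, and let the
-- sequence be its partial sums modulo p: a_0 = 0, a_{j+1} = a_j + (j-th step).
-- It has length rL + 1.  Inside the block of d the sequence is an arithmetic
-- progression c, c + d, …, c + Ld (mod p).  Since d is invertible modulo the
-- prime p, every residue u occurs among its first p terms, say at position a,
-- and then u + i·d occurs at position a + i for every i ≤ k (as p - 1 + k ≤ L).
-- Finally, for distinct residues x, y the difference y - x is non-zero, so by
-- the covering hypothesis y - x ≡ ± i·d for some d ∈ D and 1 ≤ i ≤ k; that is,
-- y ≡ x + i·d or x ≡ y + i·d, and the block of d puts x and y within distance k.

open import Defs
open import Data.Nat using (ℕ; suc; _+_; _*_; _∸_; _≤_; NonZero)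
open import Data.Nat.Primality using (Prime)
open import Data.Fin using (Fin; toℕ)
open import Data.Fin.Subset using (Subset; _∈_; ∣_∣)
open import Data.Vec using (Vec)
open import Data.Product using (Σ; ∃; ∃-syntax; _×_; _,_)
open import Relation.Binary.PropositionalEquality using (_≡_; _≢_)

open import Data.Nat using (zero; pred; _<_; _%_; ∣_-_∣; s≤s; z<s; >-nonZero)
open import Data.Nat.Properties
open import Data.Nat.DivMod using (%-distribˡ-+; %-distribˡ-*; m%n%n≡m%n; [m+n]%n≡m%n; [m+kn]%n≡m%n;
  m*n%n≡0; m<n⇒m%n≡m; m%n<n; _mod_)
open import Data.Nat.GCD using (module Bézout)
open import Data.Nat.Coprimality using (prime⇒coprime; coprime-Bézout)
open import Data.Nat.Tactic.RingSolver using (solve-∀)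
open import Data.Fin using (fromℕ<) renaming (zero to fzero; suc to fsuc)
open import Data.Fin.Properties using (toℕ-fromℕ<; toℕ-injective; toℕ<n)
open import Data.Fin.Subset using (inside; outside)
open import Data.Vec using ([]; _∷_; lookup; tabulate)
open import Data.Vec.Properties using (lookup∘tabulate)
open import Data.Vec.Base using (here; there)
open import Data.List using (List; []; _∷_; _++_; map; replicate; length)
open import Data.List.Properties using (++-assoc; map-++; map-replicate; length-++; length-map; length-replicate)
open import Data.Sum using (_⊎_; inj₁; inj₂)
open import Relation.Binary.PropositionalEquality using (refl; sym; trans; cong; cong₂; subst; module ≡-Reasoning)

ArithmeticRun : (w : ℕ → ℕ) (len L δ : ℕ) → Set
ArithmeticRun w len L δ =
  ∃[ st ] ∃[ c ] (st + L ≤ len × ((t : ℕ) → t ≤ L → w (st + t) ≡ c + t * δ))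

module Congruence (p : ℕ) .{{_ : NonZero p}} where

  infix 4 _≋_
  _≋_ : ℕ → ℕ → Set
  a ≋ b = a % p ≡ b % p

  +-≋ : ∀ {a b c d} → a ≋ b → c ≋ d → a + c ≋ b + d
  +-≋ {a} {b} {c} {d} a≋b c≋d = begin
    (a + c) % p             ≡⟨ %-distribˡ-+ a c p ⟩
    (a % p + c % p) % p     ≡⟨ cong₂ (λ u v → (u + v) % p) a≋b c≋d ⟩
    (b % p + d % p) % p     ≡⟨ %-distribˡ-+ b d p ⟨
    (b + d) % p             ∎
    where open ≡-Reasoning

  *-≋ : ∀ {a b c d} → a ≋ b → c ≋ d → a * c ≋ b * d
  *-≋ {a} {b} {c} {d} a≋b c≋d = begin
    (a * c) % p             ≡⟨ %-distribˡ-* a c p ⟩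
    (a % p * (c % p)) % p   ≡⟨ cong₂ (λ u v → (u * v) % p) a≋b c≋d ⟩
    (b % p * (d % p)) % p   ≡⟨ %-distribˡ-* b d p ⟨
    (b * d) % p             ∎
    where open ≡-Reasoning

  mod-≋ : ∀ a → a % p ≋ a
  mod-≋ a = m%n%n≡m%n a p

  ≋⇒≡ : ∀ {a b} → a < p → b < p → a ≋ b → a ≡ b
  ≋⇒≡ {a} {b} a<p b<p a≋b = trans (sym (m<n⇒m%n≡m a<p)) (trans a≋b (m<n⇒m%n≡m b<p))

  inverse : Prime p → ∀ {δ} → 0 < δ → δ < p → ∃[ y ] (y * δ ≋ 1)
  inverse p-prime {δ} 0<δ δ<p with coprime-Bézout (prime⇒coprime p-prime {{>-nonZero 0<δ}} δ<p)
  ... | Bézout.-+ x y 1+xp≡yδ = y , (begin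
    (y * δ) % p          ≡⟨ cong (_% p) 1+xp≡yδ ⟨
    (1 + x * p) % p      ≡⟨ [m+kn]%n≡m%n 1 x p ⟩
    1 % p                ∎)
    where open ≡-Reasoning
  ... | Bézout.+- x y 1+yδ≡xp = q * y , (begin
    (q * y * δ) % p                ≡⟨ [m+n]%n≡m%n (q * y * δ) p ⟨
    (q * y * δ + p) % p            ≡⟨ cong (λ n → (q * y * δ + n) % p) (suc-pred p) ⟨
    (q * y * δ + suc q) % p        ≡⟨ cong (_% p) (regroup q y δ) ⟩
    (1 + q * (1 + y * δ)) % p      ≡⟨ cong (λ n → (1 + q * n) % p) 1+yδ≡xp ⟩
    (1 + q * (x * p)) % p          ≡⟨ cong (λ n → (1 + n) % p) (*-assoc q x p) ⟨
    (1 + q * x * p) % p            ≡⟨ [m+kn]%n≡m%n 1 (q * x) p ⟩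
    1 % p                          ∎)
    where
    open ≡-Reasoning
    -- q ≡ -1 modulo p, so q·y is an inverse when y·δ ≡ -1.
    q : ℕ
    q = pred p
    regroup : ∀ q y δ → q * y * δ + suc q ≡ 1 + q * (1 + y * δ)
    regroup = solve-∀

  progression-hits : Prime p → ∀ {δ} → 0 < δ → δ < p → ∀ c u →
    ∃[ t ] (t < p × c + t * δ ≋ u)
  progression-hits p-prime {δ} 0<δ δ<p c u with inverse p-prime 0<δ δ<p
  ... | y , yδ≋1 = (y * w) % p , m%n<n (y * w) p , (begin
    (c + (y * w) % p * δ) % p   ≡⟨ +-≋ {c} refl (*-≋ (mod-≋ (y * w)) refl) ⟩
    (c + y * w * δ) % p         ≡⟨ cong (λ n → (c + n) % p) (regroup y w δ) ⟩
    (c + w * (y * δ)) % p       ≡⟨ +-≋ {c} refl (*-≋ {w} refl yδ≋1) ⟩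
    (c + w * 1) % p             ≡⟨ cong (λ n → (c + n) % p) (*-identityʳ w) ⟩
    (c + w) % p                 ≡⟨ cong (_% p) (cancel c u) ⟩
    (u + c * p) % p             ≡⟨ [m+kn]%n≡m%n u c p ⟩
    u % p                       ∎)
    where
    open ≡-Reasoning
    -- w ≡ u - c modulo p, written without subtraction.
    w : ℕ
    w = u + pred p * c
    regroup : ∀ y w δ → y * w * δ ≡ w * (y * δ)
    regroup = solve-∀
    cancel : ∀ c u → c + (u + pred p * c) ≡ u + c * p
    cancel c u = begin
      c + (u + pred p * c)   ≡⟨ +-comm c _ ⟩
      u + pred p * c + c     ≡⟨ +-assoc u _ c ⟩
      u + (pred p * c + c)   ≡⟨ cong (u +_) (+-comm (pred p * c) c) ⟩
      u + suc (pred p) * c   ≡⟨ cong (λ n → u + n * c) (suc-pred p) ⟩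
      u + p * c              ≡⟨ cong (u +_) (*-comm p c) ⟩
      u + c * p              ∎

  run-shift : ∀ {w : ℕ → ℕ} {st c L δ} → ((t : ℕ) → t ≤ L → w (st + t) ≡ c + t * δ) →
    ∀ t i {u} → t + i ≤ L → c + t * δ ≋ u → w (st + t) ≋ u × w (st + t + i) ≋ u + i * δ
  run-shift {w} {st} {c} {L} {δ} run t i {u} t+i≤L hit = first , second
    where
    open ≡-Reasoning
    first : w (st + t) ≋ u
    first = trans (cong (_% p) (run t (≤-trans (m≤m+n t i) t+i≤L))) hit
    second : w (st + t + i) ≋ u + i * δ
    second = begin
      w (st + t + i) % p          ≡⟨ cong (λ n → w n % p) (+-assoc st t i) ⟩
      w (st + (t + i)) % p        ≡⟨ cong (_% p) (run (t + i) t+i≤L) ⟩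
      (c + (t + i) * δ) % p       ≡⟨ cong (_% p) (regroup c t i δ) ⟩
      (c + t * δ + i * δ) % p     ≡⟨ +-≋ hit refl ⟩
      (u + i * δ) % p             ∎
      where
      regroup : ∀ c t i δ → c + (t + i) * δ ≡ c + t * δ + i * δ
      regroup = solve-∀

  run-contains-pair : Prime p → ∀ {w len L δ k} → 0 < δ → δ < p → p + k ∸ 1 ≤ L →
    ArithmeticRun w len L δ → ∀ u i → i ≤ k →
    ∃[ a ] (a + i ≤ len × w a ≋ u × w (a + i) ≋ u + i * δ)
  run-contains-pair p-prime {w} 0<δ δ<p long (st , c , st+L≤len , run) u i i≤k =
    let (t , t<p , hit) = progression-hits p-prime 0<δ δ<p c u
        t+i≤L = ≤-trans (∸-monoˡ-≤ 1 (+-mono-≤ t<p i≤k)) long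
        fits  = ≤-trans (≤-reflexive (+-assoc st t i)) (≤-trans (+-monoʳ-≤ st t+i≤L) st+L≤len)
    in st + t , fits , run-shift {w} {st} run t i t+i≤L hit

  difference : ∀ x y → x ≤ p → x + (y + (p ∸ x)) ≋ y
  difference x y x≤p = begin
    (x + (y + (p ∸ x))) % p    ≡⟨ cong (_% p) (+-assoc x y _) ⟨
    (x + y + (p ∸ x)) % p      ≡⟨ cong (λ n → (n + (p ∸ x)) % p) (+-comm x y) ⟩
    (y + x + (p ∸ x)) % p      ≡⟨ cong (_% p) (+-assoc y x _) ⟩
    (y + (x + (p ∸ x))) % p    ≡⟨ cong (λ n → (y + n) % p) (m+[n∸m]≡n x≤p) ⟩
    (y + p) % p                ≡⟨ [m+n]%n≡m%n y p ⟩
    y % p                      ∎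
    where open ≡-Reasoning

  zero-difference : ∀ {x y z} → x < p → y < p → x + z ≋ y → z ≋ 0 → x ≡ y
  zero-difference {x} {y} {z} x<p y<p x+z≋y z≋0 = ≋⇒≡ x<p y<p (begin
    x % p             ≡⟨ cong (_% p) (+-identityʳ x) ⟨
    (x + 0) % p       ≡⟨ +-≋ {x} refl z≋0 ⟨
    (x + z) % p       ≡⟨ x+z≋y ⟩
    y % p             ∎)
    where open ≡-Reasoning

  reduced-± : ∀ {n e} (z : Fin p) → toℕ z ≡ n % p →
    (toℕ z ≡ e % p ⊎ (toℕ z + e) % p ≡ 0) → n ≋ e ⊎ n + e ≋ 0
  reduced-± {n} {e} z z≡n% (inj₁ z≡e%) = inj₁ (trans (sym z≡n%) z≡e%)
  reduced-± {n} {e} z z≡n% (inj₂ z+e≡0) = inj₂ (begin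
    (n + e) % p          ≡⟨ +-≋ (sym (mod-≋ n)) refl ⟩
    (n % p + e) % p      ≡⟨ cong (λ m → (m + e) % p) z≡n% ⟨
    (toℕ z + e) % p      ≡⟨ z+e≡0 ⟩
    0                    ≡⟨ m*n%n≡0 0 p ⟨
    0 % p                ∎)
    where open ≡-Reasoning

  orientation : ∀ {x y z e} → x + z ≋ y → (z ≋ e ⊎ z + e ≋ 0) → x + e ≋ y ⊎ y + e ≋ x
  orientation {x} {y} {z} {e} x+z≋y (inj₁ z≋e) = inj₁ (trans (+-≋ {x} refl (sym z≋e)) x+z≋y)
  orientation {x} {y} {z} {e} x+z≋y (inj₂ z+e≋0) = inj₂ (begin
    (y + e) % p           ≡⟨ +-≋ (sym x+z≋y) refl ⟩
    (x + z + e) % p       ≡⟨ cong (_% p) (+-assoc x z e) ⟩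
    (x + (z + e)) % p     ≡⟨ +-≋ {x} refl z+e≋0 ⟩
    (x + 0) % p           ≡⟨ cong (_% p) (+-identityʳ x) ⟩
    x % p                 ∎)
    where open ≡-Reasoning

steps : ∀ {n} → ℕ → Subset n → List (Fin n)
steps L []            = []
steps L (outside ∷ s) = map fsuc (steps L s)
steps L (inside ∷ s)  = replicate L fzero ++ map fsuc (steps L s)

length-steps : ∀ {n} L (s : Subset n) → length (steps L s) ≡ ∣ s ∣ * L
length-steps L []            = refl
length-steps L (outside ∷ s) = trans (length-map fsuc (steps L s)) (length-steps L s)
length-steps L (inside ∷ s)  = begin
  length (replicate L fzero ++ map fsuc (steps L s))      ≡⟨ length-++ (replicate L fzero) ⟩
  length (replicate L fzero) + length (map fsuc (steps L s))
    ≡⟨ cong₂ _+_ (length-replicate L) (trans (length-map fsuc (steps L s)) (length-steps L s)) ⟩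
  L + ∣ s ∣ * L                                             ∎
  where open ≡-Reasoning

HasBlock : ∀ {n} → List (Fin n) → ℕ → Fin n → Set
HasBlock xs L d = ∃[ pre ] ∃[ post ] (xs ≡ pre ++ replicate L d ++ post)

shift-block : ∀ {n} {xs : List (Fin n)} {L d} → HasBlock xs L d → HasBlock (map fsuc xs) L (fsuc d)
shift-block {xs = xs} {L} {d} (pre , post , xs≡) = map fsuc pre , map fsuc post , (begin
  map fsuc xs                                              ≡⟨ cong (map fsuc) xs≡ ⟩
  map fsuc (pre ++ replicate L d ++ post)                  ≡⟨ map-++ fsuc pre _ ⟩
  map fsuc pre ++ map fsuc (replicate L d ++ post)         ≡⟨ cong (map fsuc pre ++_) (map-++ fsuc (replicate L d) post) ⟩
  map fsuc pre ++ map fsuc (replicate L d) ++ map fsuc post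
    ≡⟨ cong (λ ys → map fsuc pre ++ ys ++ map fsuc post) (map-replicate fsuc L d) ⟩
  map fsuc pre ++ replicate L (fsuc d) ++ map fsuc post    ∎)
  where open ≡-Reasoning

steps-block : ∀ {n} L (s : Subset n) {d} → d ∈ s → HasBlock (steps L s) L d
steps-block L (inside ∷ s)  here           = [] , map fsuc (steps L s) , refl
steps-block L (outside ∷ s) (there d∈s)    = shift-block (steps-block L s d∈s)
steps-block L (inside ∷ s)  (there d∈s)
  with shift-block (steps-block L s d∈s)
... | pre , post , shifted≡ = replicate L fzero ++ pre , post ,
  trans (cong (replicate L fzero ++_) shifted≡) (sym (++-assoc (replicate L fzero) pre _))

walk : ∀ {n} → List (Fin n) → ℕ → ℕ
walk xs       zero    = 0
walk []       (suc m) = 0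
walk (d ∷ xs) (suc m) = toℕ d + walk xs m

walk-++ : ∀ {n} (pre xs : List (Fin n)) t →
  walk (pre ++ xs) (length pre + t) ≡ walk pre (length pre) + walk xs t
walk-++ []        xs t = refl
walk-++ (d ∷ pre) xs t =
  trans (cong (toℕ d +_) (walk-++ pre xs t)) (sym (+-assoc (toℕ d) _ (walk xs t)))

walk-replicate : ∀ {n} L (d : Fin n) post t → t ≤ L → walk (replicate L d ++ post) t ≡ t * toℕ d
walk-replicate L       d post zero    _         = refl
walk-replicate (suc L) d post (suc t) (s≤s t≤L) = cong (toℕ d +_) (walk-replicate L d post t t≤L)

block-run : ∀ {n} {xs : List (Fin n)} {L d} → HasBlock xs L d →
  ArithmeticRun (walk xs) (length xs) L (toℕ d)
block-run {xs = xs} {L} {d} (pre , post , refl) = length pre , walk pre (length pre) , fits , run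
  where
  fits : length pre + L ≤ length (pre ++ replicate L d ++ post)
  fits = begin
    length pre + L                                      ≡⟨ cong (length pre +_) (length-replicate L) ⟨
    length pre + length (replicate L d)                 ≤⟨ +-monoʳ-≤ (length pre) (m≤m+n _ (length post)) ⟩
    length pre + (length (replicate L d) + length post) ≡⟨ cong (length pre +_) (length-++ (replicate L d)) ⟨
    length pre + length (replicate L d ++ post)         ≡⟨ length-++ pre ⟨
    length (pre ++ replicate L d ++ post)               ∎
    where open ≤-Reasoning
  run : ∀ t → t ≤ L → walk (pre ++ replicate L d ++ post) (length pre + t) ≡ walk pre (length pre) + t * toℕ d
  run t t≤L = trans (walk-++ pre _ t) (cong (walk pre (length pre) +_) (walk-replicate L d post t t≤L))

module Construction (p : ℕ) .{{_ : NonZero p}} (p-prime : Prime p) (k : ℕ) (D : Subset p)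
                    (units : (d : Fin p) → d ∈ D → toℕ d ≢ 0) where
  open Congruence p

  L : ℕ
  L = p + k ∸ 1

  stepList : List (Fin p)
  stepList = steps L D

  sequence : Vec (Fin p) (∣ D ∣ * L + 1)
  sequence = tabulate (λ j → walk stepList (toℕ j) mod p)

  read : ∀ {a} (x : Fin p) (a<m : a < ∣ D ∣ * L + 1) → walk stepList a ≋ toℕ x →
    lookup sequence (fromℕ< a<m) ≡ x
  read {a} x a<m sum≋x = toℕ-injective (begin
    toℕ (lookup sequence (fromℕ< a<m))             ≡⟨ cong toℕ (lookup∘tabulate _ (fromℕ< a<m)) ⟩
    toℕ (walk stepList (toℕ (fromℕ< a<m)) mod p)   ≡⟨ toℕ-fromℕ< (m%n<n _ p) ⟩
    walk stepList (toℕ (fromℕ< a<m)) % p           ≡⟨ cong (λ n → walk stepList n % p) (toℕ-fromℕ< a<m) ⟩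
    walk stepList a % p                            ≡⟨ sum≋x ⟩
    toℕ x % p                                      ≡⟨ m<n⇒m%n≡m (toℕ<n x) ⟩
    toℕ x                                          ∎)
    where open ≡-Reasoning

  Near : Fin p → Fin p → Set
  Near x y = ∃[ a ] ∃[ b ] (lookup sequence a ≡ x × lookup sequence b ≡ y × ∣ toℕ a - toℕ b ∣ ≤ k)

  near-sym : ∀ {x y} → Near x y → Near y x
  near-sym (a , b , a↦x , b↦y , dist) = b , a , b↦y , a↦x , subst (_≤ k) (∣-∣-comm (toℕ a) (toℕ b)) dist

  block-of : ∀ {d} → d ∈ D → ArithmeticRun (walk stepList) (∣ D ∣ * L) L (toℕ d)
  block-of {d} d∈D = subst (λ len → ArithmeticRun (walk stepList) len L (toℕ d))
                           (length-steps L D) (block-run (steps-block L D d∈D))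

  near-positions : ∀ x y a i → i ≤ k → a + i ≤ ∣ D ∣ * L →
    walk stepList a ≋ toℕ x → walk stepList (a + i) ≋ toℕ y → Near x y
  near-positions x y a i i≤k a+i≤len a≋x a+i≋y =
    fromℕ< a<m , fromℕ< a+i<m , read x a<m a≋x , read y a+i<m a+i≋y , dist
    where
    a+i<m : a + i < ∣ D ∣ * L + 1
    a+i<m = ≤-<-trans a+i≤len (m<m+n _ z<s)
    a<m : a < ∣ D ∣ * L + 1
    a<m = ≤-<-trans (m≤m+n a i) a+i<m
    dist : ∣ toℕ (fromℕ< a<m) - toℕ (fromℕ< a+i<m) ∣ ≤ k
    dist = subst (_≤ k) (sym (trans (cong₂ ∣_-_∣ (toℕ-fromℕ< a<m) (toℕ-fromℕ< a+i<m)) (∣m-m+n∣≡n a i))) i≤k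

  near-step : ∀ x y {d} → d ∈ D → ∀ i → i ≤ k → toℕ x + i * toℕ d ≋ toℕ y → Near x y
  near-step x y {d} d∈D i i≤k x+id≋y =
    let (a , a+i≤len , a≋x , a+i≋x+id) =
          run-contains-pair p-prime {walk stepList} (n≢0⇒n>0 (units d d∈D)) (toℕ<n d) ≤-refl (block-of d∈D) (toℕ x) i i≤k
    in near-positions x y a i i≤k a+i≤len a≋x (trans a+i≋x+id x+id≋y)

theorem3p1 : (p k : ℕ) → .{{_ : NonZero p}} → Prime p → 1 ≤ k →
    (D : Subset p) →
    ((d : Fin p) → d ∈ D → toℕ d ≢ 0) →
    ((x : Fin p) → toℕ x ≢ 0 → ∃[ d ] (d ∈ D × InB k p d x)) →
    Σ (Vec (Fin p) (∣ D ∣ * (p + k ∸ 1) + 1)) (IsRadiusSeq p k (∣ D ∣ * (p + k ∸ 1) + 1))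
theorem3p1 p k p-prime _ D units cover = sequence , radius
  where
  open Congruence p
  open Construction p p-prime k D units

  radius : IsRadiusSeq p k (∣ D ∣ * L + 1) sequence
  radius x y x≢y = near-either (cover z z≢0)
    where
    -- z is the residue of y - x; it is non-zero because x ≢ y.
    Z : ℕ
    Z = toℕ y + (p ∸ toℕ x)
    z : Fin p
    z = Z mod p
    z≡Z% : toℕ z ≡ Z % p
    z≡Z% = toℕ-fromℕ< (m%n<n Z p)
    x+Z≋y : toℕ x + Z ≋ toℕ y
    x+Z≋y = difference (toℕ x) (toℕ y) (<⇒≤ (toℕ<n x))
    z≢0 : toℕ z ≢ 0
    z≢0 z≡0 = x≢y (toℕ-injective (zero-difference (toℕ<n x) (toℕ<n y) x+Z≋y
      (trans (sym z≡Z%) (trans z≡0 (sym (m*n%n≡0 0 p))))))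
    near-either : ∃[ d ] (d ∈ D × InB k p d z) → Near x y
    near-either (d , d∈D , i , _ , i≤k , z≡±id) with orientation x+Z≋y (reduced-± z z≡Z% z≡±id)
    ... | inj₁ x+id≋y = near-step x y d∈D i i≤k x+id≋y
    ... | inj₂ y+id≋x = near-sym (near-step y x d∈D i i≤k y+id≋x)
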